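{- Let $d\ge1$ be fixed and $N$ prime. Let $\mathcal{G}$ be the hypergraph on $\mathbb{Z}_N$ of $d$-cubes with no coincidences. Then for every $1\le a\le 2^d$, any set of $a$ vertices of $\mathbb{Z}_N$ is contained in at most $O(N^{d-\lceil\log_2 a\rceil})$ edges of $\mathcal{G}$ (the implied constant depending only on $d$).
   Context: For $x\in\mathbb{Z}_N$ and $h\in\mathbb{Z}_N^d$, let $e_{x,h}=\{x+\omega\cdot h:\omega\in\{0,1\}^d\}$. A vector $h\in\mathbb{Z}_N^d$ has no coincidences if the $3^d$ values $\omega\cdot h$, $\omega\in\{ -1,0,1\}^d$, are pairwise distinct. Then $\mathcal{G}=\{e_{x,h}: x\in\mathbb{Z}_N,\ h \text{ has no coincidences}\}$, a $2^d$-uniform hypergraph on $\mathbb{Z}_N$. -}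

module Defs where

open import Data.Nat using (ℕ)
open import Data.Integer as ℤ using (ℤ; +_; -_; _+_; _-_; _*_)
open import Data.Integer.Divisibility using (_∣_)
open import Data.Fin using (Fin; zero; suc; toℕ)
open import Data.Fin.Subset using (Subset; _∈_)
open import Data.Bool using (Bool; true; false)
open import Data.Product using (Σ; _×_; ∃; ∃-syntax)
open import Relation.Binary.PropositionalEquality using (_≡_)
open import Function.Bundles using (_⇔_)

-- Vertices of Z_N are represented by Fin N (the residues 0..N-1).
-- Arithmetic in Z_N is expressed via congruence modulo N over ℤ.

_≡[mod_]_ : ℤ → ℕ → ℤ → Set
a ≡[mod N ] b = (+ N) ∣ (a - b)

Σℤ : (d : ℕ) → (Fin d → ℤ) → ℤ
Σℤ ℕ.zero    f = + 0
Σℤ (ℕ.suc d) f = f zero + Σℤ d (λ i → f (suc i))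

-- {-1,0,1} encoded by Fin 3: zero ↦ 0, 1 ↦ 1, 2 ↦ -1
sgn : Fin 3 → ℤ
sgn zero = + 0
sgn (suc zero) = + 1
sgn (suc (suc zero)) = - (+ 1)

bit : Bool → ℤ
bit false = + 0
bit true  = + 1

Vecᴺ : ℕ → ℕ → Set
Vecᴺ d N = Fin d → Fin N

-- ω · h for ω ∈ {-1,0,1}^d (as an integer; compared modulo N)
dot₃ : ∀ {d N} → (Fin d → Fin 3) → Vecᴺ d N → ℤ
dot₃ {d} ω h = Σℤ d (λ i → sgn (ω i) * (+ toℕ (h i)))

dot₂ : ∀ {d N} → (Fin d → Bool) → Vecᴺ d N → ℤ
dot₂ {d} ω h = Σℤ d (λ i → bit (ω i) * (+ toℕ (h i)))

NoCoincidences : ∀ {d N} → Vecᴺ d N → Set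
NoCoincidences {d} {N} h =
  ∀ (ω ω' : Fin d → Fin 3) → dot₃ ω h ≡[mod N ] dot₃ ω' h → ∀ i → ω i ≡ ω' i

IsCube : ∀ {d N} → Fin N → Vecᴺ d N → Subset N → Set
IsCube {d} {N} x h E =
  ∀ (y : Fin N) → (y ∈ E) ⇔ (∃[ ω ] ((+ toℕ y) ≡[mod N ] ((+ toℕ x) + dot₂ {d} {N} ω h)))

IsEdge : (d N : ℕ) → Subset N → Set
IsEdge d N E = ∃[ x ] ∃[ h ] (NoCoincidences {d} {N} h × IsCube {d} {N} x h E)

module Submission where

-- Let S be a set of a vertices of Z_N, 1 ≤ a ≤ 2^d, and k = ⌈log₂ a⌉.  An edge
-- E = {x + ω·h : ω ∈ {0,1}^d} through S assigns to every s ∈ S a label ω_s with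
-- s = x + ω_s·h; distinct vertices get distinct labels.  The key fact (rigidity) is
-- that the labels alone single out r = d - k "free" coordinates of h such that
-- x and h are determined by the labels together with h on the free coordinates.
-- Hence E is coded injectively by its labels and N^r values, giving at most
-- (2^d)^a · N^(d-k) ≤ (2^d)^(2^d) · N^(d-k) edges through S.
--
-- Rigidity is proved for the homogeneous system δ + Σ_{ω_i = 1} g_i = 0 over an
-- arbitrary commutative monoid, by induction on k: a list of more than 2^(k-1)
-- distinct labels is split along a coordinate where two of them differ; the larger
-- half, with that coordinate deleted, has more than 2^(k-2) distinct labels and is
-- an instance for k - 1.  It is then applied to the integers modulo N, with δ and
-- g the differences of the parameters of two edges.

open import Defs
open import Level using (0ℓ)
open import Algebra.Bundles using (CommutativeMonoid)
open import Data.Nat as ℕ using (ℕ; zero; suc; _≤_; _<_; _*_; _^_; _∸_)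
import Data.Nat.Properties as ℕ
import Data.Nat.Divisibility as ℕ
open import Data.Nat.Primality using (Prime)
open import Data.Nat.Logarithm using (⌈log₂_⌉; ⌈log₂⌉-mono-≤; ⌈log₂2^n⌉≡n)
open import Data.Integer as ℤ using (ℤ; +_; _+_; _-_)
import Data.Integer.Properties as ℤ
open import Data.Integer.Divisibility.Signed as ℤ using (∣ᵤ⇒∣; ∣⇒∣ᵤ; ∣m∣n⇒∣m-n; ∣m∣n⇒∣m+n)
open import Data.Integer.Tactic.RingSolver using (solve-∀)
open import Data.Bool using (Bool; true; false)
import Data.Bool.Properties as Bool
open import Data.Fin as Fin using (Fin; zero; suc; toℕ; punchIn; combine; funToFin; finToFun)
import Data.Fin.Properties as Fin
open import Data.Fin.Subset using (Subset; inside; outside; _∈_; _⊆_; ∣_∣)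
open import Data.Fin.Subset.Properties using (⊆-antisym)
open import Data.Vec using (Vec; []; _∷_; here; there; lookup; tabulate; removeAt; insertAt)
open import Data.Vec.Properties using (insertAt-removeAt; tabulate∘lookup; tabulate-cong)
open import Data.List as List using (List; []; _∷_; length; filter; map)
import Data.List.Properties as List
open import Data.List.Relation.Unary.All as All using (All; []; _∷_)
open import Data.List.Relation.Unary.All.Properties as All using (all-filter)
open import Data.List.Relation.Unary.AllPairs using ([]; _∷_)
import Data.List.Relation.Unary.AllPairs.Properties as AllPairs
open import Data.List.Relation.Unary.Unique.Propositional using (Unique)
import Data.List.Relation.Unary.Unique.Propositional.Properties as Unique
open import Data.List.Membership.Propositional.Properties using (∈-lookup)
open import Data.Sum using (inj₁; inj₂)
open import Data.Product using (_×_; _,_; proj₁; proj₂; ∃-syntax)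
open import Function using (_∘_; id; Inverse; Equivalence)
open import Relation.Nullary using (yes; no; contradiction)
open import Relation.Nullary.Decidable using (¬?; decidable-stable)
open import Relation.Binary.PropositionalEquality
  using (_≡_; _≢_; refl; sym; trans; cong; cong₂; subst; module ≡-Reasoning)

private variable
  A B : Set
  m : ℕ

fibre : (A → Bool) → Bool → List A → List A
fibre f b = filter (λ x → f x Bool.≟ b)

fibre-sizes : ∀ (f : A → Bool) xs →
  length (fibre f true xs) ℕ.+ length (fibre f false xs) ≡ length xs
fibre-sizes f [] = refl
fibre-sizes f (x ∷ xs) with f x
... | true  = cong suc (fibre-sizes f xs)
... | false = trans (ℕ.+-suc _ _) (cong suc (fibre-sizes f xs))

majority : (A → Bool) → List A → Bool
majority f xs with length (fibre f false xs) ℕ.≤? length (fibre f true xs)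
... | yes _ = true
... | no  _ = false

larger-half : ∀ {t u n} → t ℕ.+ u ≡ n → u ≤ t → n ≤ 2 ℕ.* t
larger-half {t} {u} refl u≤t = begin
  t ℕ.+ u      ≤⟨ ℕ.+-monoʳ-≤ t u≤t ⟩
  t ℕ.+ t      ≡⟨ cong (t ℕ.+_) (sym (ℕ.+-identityʳ t)) ⟩
  2 ℕ.* t      ∎
  where open ℕ.≤-Reasoning

majority-large : ∀ (f : A → Bool) xs → length xs ≤ 2 ℕ.* length (fibre f (majority f xs) xs)
majority-large f xs with length (fibre f false xs) ℕ.≤? length (fibre f true xs)
... | yes u≤t = larger-half (fibre-sizes f xs) u≤t
... | no  u≰t = larger-half (trans (ℕ.+-comm (length (fibre f false xs)) _) (fibre-sizes f xs))
                            (ℕ.<⇒≤ (ℕ.≰⇒> u≰t))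

map-unique : ∀ {P : A → Set} (f : A → B) → (∀ {x y} → P x → P y → f x ≡ f y → x ≡ y) →
  ∀ {xs} → All P xs → Unique xs → Unique (map f xs)
map-unique f inj [] [] = []
map-unique f inj (px ∷ pxs) (x∉xs ∷ xs!) =
  All.map⁺ (All.zipWith (λ (py , x≢y) fx≡fy → x≢y (inj px py fx≡fy)) (pxs , x∉xs))
  ∷ map-unique f inj pxs xs!

lookup-injective : ∀ {xs : List A} → Unique xs → ∀ i j → List.lookup xs i ≡ List.lookup xs j → i ≡ j
lookup-injective (_ ∷ _)     zero    zero    _ = refl
lookup-injective (x∉xs ∷ _)  zero    (suc j) e = contradiction e (All.lookup x∉xs (∈-lookup j))
lookup-injective (x∉xs ∷ _)  (suc i) zero    e = contradiction (sym e) (All.lookup x∉xs (∈-lookup i))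
lookup-injective (_ ∷ xs!)   (suc i) (suc j) e = cong suc (lookup-injective xs! i j e)

unique-length-≤ : ∀ {P : A → Set} {M} (code : ∀ {x} → P x → Fin M) →
  (∀ {x y} (px : P x) (py : P y) → code px ≡ code py → x ≡ y) →
  ∀ {xs} → Unique xs → All P xs → length xs ≤ M
unique-length-≤ {M = M} code determines {xs} xs! pxs with M ℕ.<? length xs
... | no  M≮n = ℕ.≮⇒≥ M≮n
... | yes M<n with Fin.pigeonhole M<n (λ i → code (All.lookup pxs (∈-lookup i)))
...   | i , j , i<j , same = contradiction (lookup-injective xs! i j (determines _ _ same)) (Fin.<⇒≢ i<j)

lookup-extensional : ∀ {n} (u v : Vec A n) → (∀ i → lookup u i ≡ lookup v i) → u ≡ v
lookup-extensional u v eq = trans (sym (tabulate∘lookup u)) (trans (tabulate-cong eq) (tabulate∘lookup v))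

firstDifference : Vec Bool (suc m) → Vec Bool (suc m) → Fin (suc m)
firstDifference u v with Fin.any? (λ i → ¬? (lookup u i Bool.≟ lookup v i))
... | yes (j , _) = j
... | no  _       = zero

firstDifference-differs : ∀ (u v : Vec Bool (suc m)) → u ≢ v →
  lookup u (firstDifference u v) ≢ lookup v (firstDifference u v)
firstDifference-differs u v u≢v with Fin.any? (λ i → ¬? (lookup u i Bool.≟ lookup v i))
... | yes (_ , differs) = differs
... | no  nowhere       = contradiction (lookup-extensional u v agree) u≢v
  where
  agree : ∀ i → lookup u i ≡ lookup v i
  agree i = decidable-stable (lookup u i Bool.≟ lookup v i) (λ ne → nowhere (i , ne))

removeAt-injective : ∀ (j : Fin (suc m)) (u v : Vec Bool (suc m)) →
  lookup u j ≡ lookup v j → removeAt u j ≡ removeAt v j → u ≡ v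
removeAt-injective j u v uⱼ≡vⱼ u⁻≡v⁻ = begin
  u                                  ≡⟨ insertAt-removeAt u j ⟨
  insertAt (removeAt u j) j (lookup u j) ≡⟨ cong₂ (λ w b → insertAt w j b) u⁻≡v⁻ uⱼ≡vⱼ ⟩
  insertAt (removeAt v j) j (lookup v j) ≡⟨ insertAt-removeAt v j ⟩
  v                                  ∎
  where open ≡-Reasoning

withBit : Fin m → Bool → List (Vec Bool m) → List (Vec Bool m)
withBit j = fibre (λ ω → lookup ω j)

majorityBit : Fin m → List (Vec Bool m) → Bool
majorityBit j = majority (λ ω → lookup ω j)

halve : Fin (suc m) → List (Vec Bool (suc m)) → List (Vec Bool m)
halve j P = map (λ ω → removeAt ω j) (withBit j (majorityBit j P) P)

splitCoord : List (Vec Bool (suc m)) → Fin (suc m)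
splitCoord (u ∷ v ∷ _) = firstDifference u v
splitCoord _           = zero

-- The "free" coordinates of a list of labels P in dimension k + r: split P along
-- splitCoord k times, always keeping the larger half; the r coordinates that are
-- never split along are free.  They depend on the labels only.
freeCoords : ∀ k {r m} → k ℕ.+ r ≡ m → List (Vec Bool m) → Fin r → Fin m
freeCoords zero    refl P = id
freeCoords (suc k) refl P = punchIn j ∘ freeCoords k refl (halve j P)
  where j = splitCoord P

halve-unique : ∀ (j : Fin (suc m)) {P} → Unique P → Unique (halve j P)
halve-unique j {P} P! =
  map-unique (λ ω → removeAt ω j) same-bit-injective
    (all-filter bitTest P) (AllPairs.filter⁺ bitTest P!)
  where
  b = majorityBit j P
  bitTest = λ ω → lookup ω j Bool.≟ b
  same-bit-injective : ∀ {u v} → lookup u j ≡ b → lookup v j ≡ b →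
    removeAt u j ≡ removeAt v j → u ≡ v
  same-bit-injective uⱼ≡b vⱼ≡b = removeAt-injective j _ _ (trans uⱼ≡b (sym vⱼ≡b))

halve-large : ∀ k (j : Fin (suc m)) P →
  2 ^ suc k < 2 ℕ.* length P → 2 ^ k < 2 ℕ.* length (halve j P)
halve-large k j P bound = begin-strict
  2 ^ k                    <⟨ ℕ.*-cancelˡ-< 2 (2 ^ k) (length P) bound ⟩
  length P                 ≤⟨ majority-large (λ ω → lookup ω j) P ⟩
  2 ℕ.* length majorityHalf ≡⟨ cong (2 ℕ.*_) (List.length-map (λ ω → removeAt ω j) majorityHalf) ⟨
  2 ℕ.* length (halve j P)  ∎
  where
  open ℕ.≤-Reasoning
  majorityHalf = withBit j (majorityBit j P) P

module Rigidity {c ℓ} (M : CommutativeMonoid c ℓ) where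

  open CommutativeMonoid M
    renaming (Carrier to G; refl to ≈-refl; sym to ≈-sym; trans to ≈-trans)
  open import Algebra.Properties.CommutativeSemigroup commutativeSemigroup using (x∙yz≈y∙xz)
  open import Relation.Binary.Reasoning.Setoid setoid

  infixr 8 _·_
  _·_ : Bool → G → G
  true  · g = g
  false · g = ε

  ⟨_,_⟩ : ∀ {m} → Vec Bool m → (Fin m → G) → G
  ⟨ []    , g ⟩ = ε
  ⟨ b ∷ ω , g ⟩ = b · g zero ∙ ⟨ ω , g ∘ suc ⟩

  ⟨⟩-split : ∀ {m} (ω : Vec Bool (suc m)) g j →
    ⟨ ω , g ⟩ ≈ lookup ω j · g j ∙ ⟨ removeAt ω j , g ∘ punchIn j ⟩
  ⟨⟩-split (b ∷ ω)         g zero    = ≈-refl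
  ⟨⟩-split (b ∷ ω@(_ ∷ _)) g (suc j) = begin
    b · g zero ∙ ⟨ ω , g ∘ suc ⟩
      ≈⟨ ∙-congˡ (⟨⟩-split ω (g ∘ suc) j) ⟩
    b · g zero ∙ (lookup ω j · g (suc j) ∙ ⟨ removeAt ω j , g ∘ suc ∘ punchIn j ⟩)
      ≈⟨ x∙yz≈y∙xz _ _ _ ⟩
    lookup ω j · g (suc j) ∙ (b · g zero ∙ ⟨ removeAt ω j , g ∘ suc ∘ punchIn j ⟩) ∎

  ⟨⟩-vanish : ∀ {m} (ω : Vec Bool m) {g} → (∀ i → g i ≈ ε) → ⟨ ω , g ⟩ ≈ ε
  ⟨⟩-vanish []          g≈ε = ≈-refl
  ⟨⟩-vanish (true  ∷ ω) g≈ε = ≈-trans (∙-cong (g≈ε zero) (⟨⟩-vanish ω (g≈ε ∘ suc))) (identityˡ ε)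
  ⟨⟩-vanish (false ∷ ω) g≈ε = ≈-trans (∙-congˡ (⟨⟩-vanish ω (g≈ε ∘ suc))) (identityˡ ε)

  Solves : ∀ {m} → G → (Fin m → G) → Vec Bool m → Set ℓ
  Solves δ g ω = δ ∙ ⟨ ω , g ⟩ ≈ ε

  restrict : ∀ {m} (j : Fin (suc m)) ω {b δ g} → lookup ω j ≡ b → Solves δ g ω →
    Solves (δ ∙ b · g j) (g ∘ punchIn j) (removeAt ω j)
  restrict j ω {b} {δ} {g} refl sol = begin
    (δ ∙ b · g j) ∙ ⟨ removeAt ω j , g ∘ punchIn j ⟩ ≈⟨ assoc _ _ _ ⟩
    δ ∙ (b · g j ∙ ⟨ removeAt ω j , g ∘ punchIn j ⟩) ≈⟨ ∙-congˡ (⟨⟩-split ω g j) ⟨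
    δ ∙ ⟨ ω , g ⟩                                      ≈⟨ sol ⟩
    ε                                                  ∎

  halve-solves : ∀ {m} (j : Fin (suc m)) {δ g P} → All (Solves δ g) P →
    All (Solves (δ ∙ majorityBit j P · g j) (g ∘ punchIn j)) (halve j P)
  halve-solves j {P = P} sols = All.map⁺ (All.zipWith (λ {ω} (bit , sol) → restrict j ω bit sol)
    (all-filter (λ ω → lookup ω j Bool.≟ majorityBit j P) P , All.filter⁺ _ sols))

  zero-and-one : ∀ {δ x} → δ ∙ ε ≈ ε → δ ∙ x ≈ ε → δ ≈ ε × x ≈ ε
  zero-and-one {δ} {x} e₀ e₁ = δ≈ε , x≈ε
    where
    δ≈ε = ≈-trans (≈-sym (identityʳ δ)) e₀
    x≈ε = begin
      x     ≈⟨ identityˡ x ⟨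
      ε ∙ x ≈⟨ ∙-congʳ δ≈ε ⟨
      δ ∙ x ≈⟨ e₁ ⟩
      ε     ∎

  bits-determine : ∀ {b₀ b₁ δ x} → b₀ ≢ b₁ → δ ∙ b₀ · x ≈ ε → δ ∙ b₁ · x ≈ ε → δ ≈ ε × x ≈ ε
  bits-determine {true}  {true}  b₀≢b₁ = contradiction refl b₀≢b₁
  bits-determine {false} {false} b₀≢b₁ = contradiction refl b₀≢b₁
  bits-determine {true}  {false} _ e₁ e₀ = zero-and-one e₀ e₁
  bits-determine {false} {true}  _ e₀ e₁ = zero-and-one e₀ e₁

  -- If (δ, g) solves all equations of P and g vanishes on the free
  -- coordinates of P, then δ = 0 and g = 0.  Induction on k: split P along a
  -- coordinate j where two of its labels differ; the larger half, with coordinate j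
  -- deleted, is an instance for k - 1, so g vanishes off j; then the two labels
  -- differing at j give δ + 0 = 0 and δ + g_j = 0.
  rigidity : ∀ k {r m} (e : k ℕ.+ r ≡ m) (P : List (Vec Bool m)) → Unique P →
    2 ^ k < 2 ℕ.* length P → ∀ δ g → All (Solves δ g) P →
    (∀ t → g (freeCoords k e P t) ≈ ε) → δ ≈ ε × (∀ i → g i ≈ ε)
  rigidity zero refl [] _ ()
  rigidity zero refl (ω ∷ _) _ _ δ g (sol ∷ _) g≈ε = δ≈ε , g≈ε
    where
    δ≈ε = begin
      δ               ≈⟨ identityʳ δ ⟨
      δ ∙ ε           ≈⟨ ∙-congˡ (⟨⟩-vanish ω g≈ε) ⟨
      δ ∙ ⟨ ω , g ⟩   ≈⟨ sol ⟩
      ε               ∎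
  rigidity (suc k) refl [] _ ()
  rigidity (suc k) refl (ω ∷ []) _ bound =
    contradiction (ℕ.*-cancelˡ-< 2 (2 ^ k) 1 bound) (ℕ.≤⇒≯ (ℕ.m^n>0 2 k))
  rigidity (suc k) refl P@(u ∷ v ∷ _) P!@((u≢v ∷ _) ∷ _) bound δ g sols gF = δ≈ε , g≈ε
    where
    j = firstDifference u v
    b = majorityBit j P
    smaller : (δ ∙ b · g j) ≈ ε × (∀ i → g (punchIn j i) ≈ ε)
    smaller = rigidity k refl (halve j P) (halve-unique j P!) (halve-large k j P bound)
      (δ ∙ b · g j) (g ∘ punchIn j) (halve-solves j sols) gF
    -- with g = 0 off j, each equation reduces to its j-th term
    reduced : ∀ ω → Solves δ g ω → δ ∙ lookup ω j · g j ≈ ε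
    reduced ω sol = begin
      δ ∙ lookup ω j · g j                                   ≈⟨ identityʳ _ ⟨
      (δ ∙ lookup ω j · g j) ∙ ε                             ≈⟨ ∙-congˡ (⟨⟩-vanish (removeAt ω j) (proj₂ smaller)) ⟨
      (δ ∙ lookup ω j · g j) ∙ ⟨ removeAt ω j , g ∘ punchIn j ⟩ ≈⟨ restrict j ω refl sol ⟩
      ε                                                      ∎
    pinned : δ ≈ ε × g j ≈ ε
    pinned = bits-determine (firstDifference-differs u v u≢v)
      (reduced u (All.head sols)) (reduced v (All.head (All.tail sols)))
    δ≈ε = proj₁ pinned
    g≈ε : ∀ i → g i ≈ ε
    g≈ε i with i Fin.≟ j
    ... | yes refl = proj₂ pinned
    ... | no  i≢j  = subst (λ i → g i ≈ ε) (Fin.punchIn-punchOut (i≢j ∘ sym)) (proj₂ smaller _)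

-- Congruence of integers modulo N.  It is wrapped in a record so that both sides
-- can be recovered from a congruence by unification.
record Congruent (N : ℕ) (a b : ℤ) : Set where
  constructor congruent
  field divides : + N ℤ.∣ a - b

+-minus-+ : ∀ a b c d → (a + c) - (b + d) ≡ (a - b) + (c - d)
+-minus-+ = solve-∀

module _ {N : ℕ} where

  congruent-via : ∀ {a b} t → a - b ≡ t → + N ℤ.∣ t → Congruent N a b
  congruent-via t eq N∣t = congruent (subst (+ N ℤ.∣_) (sym eq) N∣t)

  ≡⇒congruent : ∀ {a b} → a ≡ b → Congruent N a b
  ≡⇒congruent {a} refl = congruent-via (+ 0) (ℤ.+-inverseʳ a) (∣ᵤ⇒∣ (N ℕ.∣0))

  congruent-sym : ∀ {a b} → Congruent N a b → Congruent N b a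
  congruent-sym {a} {b} (congruent N∣a-b) =
    congruent-via (ℤ.- (a - b)) (identity a b) (ℤ.∣m⇒∣-m N∣a-b)
    where identity : ∀ a b → b - a ≡ ℤ.- (a - b)
          identity = solve-∀

  congruent-trans : ∀ {a b c} → Congruent N a b → Congruent N b c → Congruent N a c
  congruent-trans {a} {b} {c} (congruent N∣a-b) (congruent N∣b-c) =
    congruent-via ((a - b) + (b - c)) (identity a b c) (∣m∣n⇒∣m+n N∣a-b N∣b-c)
    where identity : ∀ a b c → a - c ≡ (a - b) + (b - c)
          identity = solve-∀

  congruent-+ : ∀ {a b c d} → Congruent N a b → Congruent N c d → Congruent N (a + c) (b + d)
  congruent-+ {a} {b} {c} {d} (congruent N∣a-b) (congruent N∣c-d) =
    congruent-via ((a - b) + (c - d)) (+-minus-+ a b c d) (∣m∣n⇒∣m+n N∣a-b N∣c-d)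

ℤ-mod : ℕ → CommutativeMonoid 0ℓ 0ℓ
ℤ-mod N = record
  { Carrier             = ℤ
  ; _≈_                 = Congruent N
  ; _∙_                 = _+_
  ; ε                   = + 0
  ; isCommutativeMonoid = record
    { isMonoid = record
      { isSemigroup = record
        { isMagma = record
          { isEquivalence = record
            { refl = ≡⇒congruent refl ; sym = congruent-sym ; trans = congruent-trans }
          ; ∙-cong        = congruent-+
          }
        ; assoc = λ a b c → ≡⇒congruent (ℤ.+-assoc a b c)
        }
      ; identity = (λ a → ≡⇒congruent (ℤ.+-identityˡ a)) , (λ a → ≡⇒congruent (ℤ.+-identityʳ a))
      }
    ; comm = λ a b → ≡⇒congruent (ℤ.+-comm a b)
    }
  }

small-multiple : ∀ {N n} → n < N → N ℕ.∣ n → n ≡ 0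
small-multiple {n = zero}  _   _   = refl
small-multiple {n = suc n} n<N N∣n = contradiction N∣n (ℕ.>⇒∤ n<N)

ordered-residues-equal : ∀ {N} {a b : Fin N} → toℕ a ≤ toℕ b →
  Congruent N (+ toℕ a) (+ toℕ b) → a ≡ b
ordered-residues-equal {N} {a} {b} a≤b (congruent N∣a-b) =
  Fin.toℕ-injective (ℕ.≤-antisym a≤b (ℕ.m∸n≡0⇒m≤n b∸a≡0))
  where
  N∣b∸a : N ℕ.∣ toℕ b ℕ.∸ toℕ a
  ∣a-b∣≡b∸a : ℤ.∣ + toℕ a - + toℕ b ∣ ≡ toℕ b ℕ.∸ toℕ a
  ∣a-b∣≡b∸a = trans (cong ℤ.∣_∣ (ℤ.[+m]-[+n]≡m⊖n (toℕ a) (toℕ b))) (ℤ.∣⊖∣-≤ a≤b)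
  N∣b∸a = subst (N ℕ.∣_) ∣a-b∣≡b∸a (∣⇒∣ᵤ N∣a-b)
  b∸a≡0 = small-multiple (ℕ.≤-<-trans (ℕ.m∸n≤m (toℕ b) (toℕ a)) (Fin.toℕ<n b)) N∣b∸a

residue-injective : ∀ {N} {a b : Fin N} → Congruent N (+ toℕ a) (+ toℕ b) → a ≡ b
residue-injective {a = a} {b} a≡b with ℕ.≤-total (toℕ a) (toℕ b)
... | inj₁ a≤b = ordered-residues-equal a≤b a≡b
... | inj₂ b≤a = sym (ordered-residues-equal b≤a (congruent-sym a≡b))

subtract-equations : ∀ {N s} x x' D D' → Congruent N s (x + D) → Congruent N s (x' + D') →
  Congruent N ((x - x') + (D - D')) (+ 0)
subtract-equations {s = s} x x' D D' (congruent N∣s-x-D) (congruent N∣s-x'-D') =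
  congruent-via _ (identity s x x' D D') (∣m∣n⇒∣m-n N∣s-x'-D' N∣s-x-D)
  where identity : ∀ s x x' D D' → ((x - x') + (D - D')) - + 0 ≡ (s - (x' + D')) - (s - (x + D))
        identity = solve-∀

difference-vanishes : ∀ {N a b} → Congruent N (a - b) (+ 0) → Congruent N a b
difference-vanishes {a = a} {b} (congruent N∣a-b-0) =
  congruent (subst (_ ℤ.∣_) (ℤ.+-identityʳ (a - b)) N∣a-b-0)

module IntegerCubes (N : ℕ) where

  open Rigidity (ℤ-mod N) public

  bit-· : ∀ b z → bit b ℤ.* z ≡ b · z
  bit-· true  z = ℤ.*-identityˡ z
  bit-· false z = refl

  dot₂-as-sum : ∀ {d} (ω : Fin d → Bool) (h : Vecᴺ d N) →
    dot₂ ω h ≡ ⟨ tabulate ω , (λ i → + toℕ (h i)) ⟩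
  dot₂-as-sum {zero}  ω h = refl
  dot₂-as-sum {suc d} ω h =
    cong₂ _+_ (bit-· (ω zero) (+ toℕ (h zero))) (dot₂-as-sum (ω ∘ suc) (h ∘ suc))

  ⟨⟩-difference : ∀ {m} (ω : Vec Bool m) (u v : Fin m → ℤ) →
    ⟨ ω , u ⟩ - ⟨ ω , v ⟩ ≡ ⟨ ω , (λ i → u i - v i) ⟩
  ⟨⟩-difference []      u v = refl
  ⟨⟩-difference (b ∷ ω) u v = begin
    (b · u zero + ⟨ ω , u ∘ suc ⟩) - (b · v zero + ⟨ ω , v ∘ suc ⟩)
      ≡⟨ +-minus-+ (b · u zero) (b · v zero) _ _ ⟩
    (b · u zero - b · v zero) + (⟨ ω , u ∘ suc ⟩ - ⟨ ω , v ∘ suc ⟩)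
      ≡⟨ cong₂ _+_ (·-difference b) (⟨⟩-difference ω (u ∘ suc) (v ∘ suc)) ⟩
    b · (u zero - v zero) + ⟨ ω , (λ i → u (suc i) - v (suc i)) ⟩ ∎
    where
    open ≡-Reasoning
    ·-difference : ∀ b → b · u zero - b · v zero ≡ b · (u zero - v zero)
    ·-difference true  = refl
    ·-difference false = refl

⌈log₂⌉-≤ : ∀ {a d} → a ≤ 2 ^ d → ⌈log₂ a ⌉ ≤ d
⌈log₂⌉-≤ {a} {d} a≤2^d = subst (⌈log₂ a ⌉ ≤_) (⌈log₂2^n⌉≡n d) (⌈log₂⌉-mono-≤ a≤2^d)

-- 2^⌈log₂ a⌉ < 2a for a ≥ 1: if 2a ≤ 2^(k+1) then a ≤ 2^k, so ⌈log₂ a⌉ ≤ k.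
2^⌈log₂⌉<2* : ∀ a → 1 ≤ a → 2 ^ ⌈log₂ a ⌉ < 2 * a
2^⌈log₂⌉<2* a 1≤a with ⌈log₂ a ⌉ in eq
... | zero  = ℕ.*-monoʳ-≤ 2 1≤a
... | suc k = ℕ.≰⇒> λ 2a≤2^k+1 →
  ℕ.n≮n k (subst (_≤ k) eq (⌈log₂⌉-≤ {a} (ℕ.*-cancelˡ-≤ 2 2a≤2^k+1)))

enum : ∀ {n} (S : Subset n) → Fin ∣ S ∣ → Fin n
enum (inside  ∷ S) zero    = zero
enum (inside  ∷ S) (suc i) = suc (enum S i)
enum (outside ∷ S) i       = suc (enum S i)

enum-∈ : ∀ {n} (S : Subset n) i → enum S i ∈ S
enum-∈ (inside  ∷ S) zero    = here
enum-∈ (inside  ∷ S) (suc i) = there (enum-∈ S i)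
enum-∈ (outside ∷ S) i       = there (enum-∈ S i)

enum-injective : ∀ {n} (S : Subset n) {i j} → enum S i ≡ enum S j → i ≡ j
enum-injective (inside  ∷ S) {zero}  {zero}  _ = refl
enum-injective (inside  ∷ S) {suc i} {suc j} e = cong suc (enum-injective S (Fin.suc-injective e))
enum-injective (outside ∷ S)                 e = enum-injective S (Fin.suc-injective e)

funToFin-injective : ∀ {m n} {f g : Fin m → Fin n} → funToFin f ≡ funToFin g → ∀ i → f i ≡ g i
funToFin-injective {f = f} {g} eq i = begin
  f i                     ≡⟨ Fin.finToFun-funToFin f i ⟨
  finToFun (funToFin f) i ≡⟨ cong (λ c → finToFun c i) eq ⟩
  finToFun (funToFin g) i ≡⟨ Fin.finToFun-funToFin g i ⟩
  g i                     ∎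
  where open ≡-Reasoning

labelCode : ∀ {d} → Vec Bool d → Fin (2 ^ d)
labelCode ω = funToFin (Inverse.from Fin.2↔Bool ∘ lookup ω)

labelCode-injective : ∀ {d} {u v : Vec Bool d} → labelCode u ≡ labelCode v → u ≡ v
labelCode-injective {u = u} {v} eq = lookup-extensional u v λ i → begin
  lookup u i                      ≡⟨ Inverse.strictlyInverseˡ Fin.2↔Bool (lookup u i) ⟨
  Inverse.to Fin.2↔Bool (bitOf u i) ≡⟨ cong (Inverse.to Fin.2↔Bool) (funToFin-injective eq i) ⟩
  Inverse.to Fin.2↔Bool (bitOf v i) ≡⟨ Inverse.strictlyInverseˡ Fin.2↔Bool (lookup v i) ⟩
  lookup v i                      ∎
  where
  open ≡-Reasoning
  bitOf = λ (w : Vec Bool _) i → Inverse.from Fin.2↔Bool (lookup w i)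

Σℤ-cong : ∀ d {f g : Fin d → ℤ} → (∀ i → f i ≡ g i) → Σℤ d f ≡ Σℤ d g
Σℤ-cong zero    f≗g = refl
Σℤ-cong (suc d) f≗g = cong₂ _+_ (f≗g zero) (Σℤ-cong d (f≗g ∘ suc))

cube-⊆ : ∀ {d N x x' h h' E E'} → IsCube {d} {N} x h E → IsCube x' h' E' →
  x ≡ x' → (∀ i → h i ≡ h' i) → E ⊆ E'
cube-⊆ {d} {N} {x} {h = h} {h'} cube cube' refl h≗h' {y} y∈E
  with ω , y≡x+ωh ← Equivalence.to (cube y) y∈E =
  Equivalence.from (cube' y) (ω , subst (λ D → (+ toℕ y) ≡[mod N ] ((+ toℕ x) + D)) ωh≡ωh' y≡x+ωh)
  where
  ωh≡ωh' : dot₂ ω h ≡ dot₂ ω h'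
  ωh≡ωh' = Σℤ-cong d (λ i → cong (λ z → bit (ω i) ℤ.* + toℕ z) (h≗h' i))

cube-unique : ∀ {d N x x' h h' E E'} → IsCube {d} {N} x h E → IsCube x' h' E' →
  x ≡ x' → (∀ i → h i ≡ h' i) → E ≡ E'
cube-unique cube cube' x≡x' h≗h' =
  ⊆-antisym (cube-⊆ cube cube' x≡x' h≗h') (cube-⊆ cube' cube (sym x≡x') (sym ∘ h≗h'))

module EdgesThrough {d N : ℕ} (S : Subset N) where

  open IntegerCubes N

  EdgeThrough : Subset N → Set
  EdgeThrough E = IsEdge d N E × S ⊆ E

  ⟦_⟧ : Fin N → ℤ
  ⟦ a ⟧ = + toℕ a

  module _ {E} (through : EdgeThrough E) where

    base : Fin N
    base = proj₁ (proj₁ through)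

    direction : Vecᴺ d N
    direction = proj₁ (proj₂ (proj₁ through))

    cube : IsCube base direction E
    cube = proj₂ (proj₂ (proj₂ (proj₁ through)))

    directionℤ : Fin d → ℤ
    directionℤ = ⟦_⟧ ∘ direction

    label : Fin ∣ S ∣ → Vec Bool d
    label i = tabulate (proj₁ (Equivalence.to (cube (enum S i)) (proj₂ through (enum-∈ S i))))

    label-equation : ∀ i → Congruent N ⟦ enum S i ⟧ (⟦ base ⟧ + ⟨ label i , directionℤ ⟩)
    label-equation i with ω , s≡x+ωh ← Equivalence.to (cube (enum S i)) (proj₂ through (enum-∈ S i)) =
      subst (λ D → Congruent N ⟦ enum S i ⟧ (⟦ base ⟧ + D)) (dot₂-as-sum ω direction)
        (congruent (∣ᵤ⇒∣ s≡x+ωh))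

    label-equation′ : ∀ {i ω} → label i ≡ ω → Congruent N ⟦ enum S i ⟧ (⟦ base ⟧ + ⟨ ω , directionℤ ⟩)
    label-equation′ {i} refl = label-equation i

    label-injective : ∀ {i j} → label i ≡ label j → i ≡ j
    label-injective {i} {j} ℓᵢ≡ℓⱼ = enum-injective S (residue-injective
      (congruent-trans (label-equation i) (congruent-sym (label-equation′ (sym ℓᵢ≡ℓⱼ)))))

    labels : List (Vec Bool d)
    labels = List.tabulate label

    labels-unique : Unique labels
    labels-unique = Unique.tabulate⁺ label-injective

  differences-solve : ∀ {E E'} (t : EdgeThrough E) (t' : EdgeThrough E') →
    (∀ i → label t i ≡ label t' i) →
    ∀ i → Solves (⟦ base t ⟧ - ⟦ base t' ⟧) (λ j → directionℤ t j - directionℤ t' j) (label t i)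
  differences-solve t t' same-labels i =
    subst (λ D → Congruent N ((⟦ base t ⟧ - ⟦ base t' ⟧) + D) (+ 0))
      (⟨⟩-difference (label t i) (directionℤ t) (directionℤ t'))
      (subtract-equations ⟦ base t ⟧ ⟦ base t' ⟧ ⟨ label t i , directionℤ t ⟩ ⟨ label t i , directionℤ t' ⟩
        (label-equation t i) (label-equation′ t' (sym (same-labels i))))

  module Coding {k r} (k+r≡d : k ℕ.+ r ≡ d) where

    free : ∀ {E} → EdgeThrough E → Fin r → Fin d
    free through = freeCoords k k+r≡d (labels through)

    code : ∀ {E} → EdgeThrough E → Fin ((2 ^ d) ^ ∣ S ∣ * N ^ r)
    code t = combine (funToFin (labelCode ∘ label t)) (funToFin (direction t ∘ free t))

    determined : 2 ^ k < 2 * ∣ S ∣ → ∀ {E E'} (t : EdgeThrough E) (t' : EdgeThrough E') →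
      (∀ i → label t i ≡ label t' i) → (∀ j → direction t (free t j) ≡ direction t' (free t j)) →
      E ≡ E'
    determined bound t t' same-labels same-free =
      cube-unique (cube t) (cube t') (residue-injective (difference-vanishes (proj₁ trivial)))
        (λ i → residue-injective (difference-vanishes (proj₂ trivial i)))
      where
      free-vanish : ∀ j → Congruent N (directionℤ t (free t j) - directionℤ t' (free t j)) (+ 0)
      free-vanish j = ≡⇒congruent (trans (cong (λ a → directionℤ t (free t j) - ⟦ a ⟧) (sym (same-free j)))
        (ℤ.+-inverseʳ (directionℤ t (free t j))))
      many-labels : 2 ^ k < 2 * length (labels t)
      many-labels = subst (λ n → 2 ^ k < 2 * n) (sym (List.length-tabulate (label t))) bound
      trivial = rigidity k k+r≡d (labels t) (labels-unique t) many-labels _ _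
        (All.tabulate⁺ (differences-solve t t' same-labels)) free-vanish

    code-injective : 2 ^ k < 2 * ∣ S ∣ → ∀ {E E'} (t : EdgeThrough E) (t' : EdgeThrough E') →
      code t ≡ code t' → E ≡ E'
    code-injective bound t t' same-code = determined bound t t' same-labels same-free
      where
      codes = Fin.combine-injective _ _ _ _ same-code
      same-labels = λ i → labelCode-injective (funToFin-injective (proj₁ codes) i)
      same-free = λ j → trans (funToFin-injective (proj₂ codes) j)
        (cong (λ P → direction t' (freeCoords k k+r≡d P j)) (sym (List.tabulate-cong same-labels)))

  edges-through-bound : 1 ≤ ∣ S ∣ → ∣ S ∣ ≤ 2 ^ d → ∀ {L} → Unique L → All EdgeThrough L →
    length L ≤ (2 ^ d) ^ ∣ S ∣ * N ^ (d ∸ ⌈log₂ ∣ S ∣ ⌉)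
  edges-through-bound 1≤∣S∣ ∣S∣≤2^d L! through =
    unique-length-≤ code (code-injective (2^⌈log₂⌉<2* ∣ S ∣ 1≤∣S∣)) L! through
    where open Coding {k = ⌈log₂ ∣ S ∣ ⌉} (ℕ.m+[n∸m]≡n (⌈log₂⌉-≤ ∣S∣≤2^d))

lemma2p2 : (d : ℕ) → 1 ≤ d →
    ∃[ C ] (∀ (N : ℕ) → Prime N →
      ∀ (a : ℕ) → 1 ≤ a → a ≤ 2 ^ d →
      ∀ (S : Subset N) → ∣ S ∣ ≡ a →
      ∀ (L : List (Subset N)) → Unique L →
      All (λ E → IsEdge d N E × S ⊆ E) L →
      length L ≤ C * N ^ (d ∸ ⌈log₂ a ⌉))
lemma2p2 d _ = (2 ^ d) ^ (2 ^ d) , bound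
  where
  bound : ∀ N → Prime N → ∀ a → 1 ≤ a → a ≤ 2 ^ d → ∀ S → ∣ S ∣ ≡ a →
    ∀ L → Unique L → All (λ E → IsEdge d N E × S ⊆ E) L →
    length L ≤ (2 ^ d) ^ (2 ^ d) * N ^ (d ∸ ⌈log₂ a ⌉)
  bound N _ a 1≤a a≤2^d S refl L L! through = begin
    length L                           ≤⟨ EdgesThrough.edges-through-bound S 1≤a a≤2^d L! through ⟩
    (2 ^ d) ^ a * N ^ (d ∸ ⌈log₂ a ⌉)  ≤⟨ ℕ.*-monoˡ-≤ _ (ℕ.^-monoʳ-≤ (2 ^ d) {{ℕ.m^n≢0 2 d}} a≤2^d) ⟩
    (2 ^ d) ^ (2 ^ d) * N ^ (d ∸ ⌈log₂ a ⌉) ∎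
    where open ℕ.≤-Reasoning
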